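{- Let $\ell$ be a prime, let $g$ be an element of $\mathfrak{sl}_2 (\mathbb{Z}_\ell)$, let $w$ be a vector in $\mathbb{Z}_\ell^2$, and let $\beta$ be the minimal $\ell$-adic valuation of the coefficients of $w$. Let $\lambda \in \mathbb{Z}_\ell$ and $n$ a positive integer, and suppose $g w \equiv \lambda w \pmod{\ell^n}$. Then either $g$ has an eigenvalue $\nu \in \mathbb{Z}_\ell$ such that $v_\ell(\nu-\lambda) \geq v_\ell(\lambda)+3$, or else $\beta \geq n-2(2+v_\ell(\lambda))$.
   Context: $\mathfrak{sl}_2(\mathbb{Z}_\ell)$ is the set of $2\times 2$ trace-zero matrices with entries in $\mathbb{Z}_\ell$, acting on $\mathbb{Z}_\ell^2$; $v_\ell$ is the $\ell$-adic valuation. -}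

module Defs where

open import Data.Nat as ℕ using (ℕ; suc; _^_)
open import Data.Integer as ℤ using (ℤ; +_; _+_; _*_; -_; _-_)
open import Data.Fin using (Fin; zero; suc)
open import Data.Product using (∃; _,_; _×_)
open import Relation.Binary.PropositionalEquality
open import Relation.Nullary using (¬_)
open import Data.Integer.Solver using (module +-*-Solver)
open +-*-Solver

pw : ℕ → ℕ → ℤ
pw ℓ k = + (ℓ ^ k)

-- ℓ-adic integers ℤ_ℓ, as coherent sequences (x_k)_k of integers with
-- x_{k+1} ≡ x_k (mod ℓ^k); x_k represents x modulo ℓ^k.
record ℤ[_] (ℓ : ℕ) : Set where
  constructor mk
  field
    seq : ℕ → ℤ
    coh : ∀ k → ∃ λ q → seq (suc k) ≡ seq k + q * pw ℓ k
open ℤ[_] public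

module _ {ℓ : ℕ} where

  fromℤ : ℤ → ℤ[ ℓ ]
  fromℤ a = mk (λ _ → a) (λ k → + 0 , solve 2 (λ a m → a := a :+ con (+ 0) :* m) refl a (pw ℓ k))

  infixl 6 _⊕_ _⊖_
  infixl 7 _⊗_

  _⊕_ : ℤ[ ℓ ] → ℤ[ ℓ ] → ℤ[ ℓ ]
  x ⊕ y = mk (λ k → seq x k + seq y k) c
    where
    c : ∀ k → ∃ λ q → seq x (suc k) + seq y (suc k) ≡ (seq x k + seq y k) + q * pw ℓ k
    c k with coh x k | coh y k
    ... | p , ex | q , ey = p + q , trans (cong₂ _+_ ex ey)
          (solve 5 (λ a b p q m → (a :+ p :* m) :+ (b :+ q :* m) := (a :+ b) :+ (p :+ q) :* m)
                 refl (seq x k) (seq y k) p q (pw ℓ k))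

  ⊝_ : ℤ[ ℓ ] → ℤ[ ℓ ]
  ⊝ x = mk (λ k → - seq x k) c
    where
    c : ∀ k → ∃ λ q → - seq x (suc k) ≡ - seq x k + q * pw ℓ k
    c k with coh x k
    ... | p , ex = - p , trans (cong -_ ex)
          (solve 3 (λ a p m → :- (a :+ p :* m) := :- a :+ (:- p) :* m) refl (seq x k) p (pw ℓ k))

  _⊖_ : ℤ[ ℓ ] → ℤ[ ℓ ] → ℤ[ ℓ ]
  x ⊖ y = x ⊕ (⊝ y)

  _⊗_ : ℤ[ ℓ ] → ℤ[ ℓ ] → ℤ[ ℓ ]
  x ⊗ y = mk (λ k → seq x k * seq y k) c
    where
    c : ∀ k → ∃ λ q → seq x (suc k) * seq y (suc k) ≡ seq x k * seq y k + q * pw ℓ k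
    c k with coh x k | coh y k
    ... | p , ex | q , ey = seq x k * q + p * (seq y k + q * pw ℓ k) , trans (cong₂ _*_ ex ey)
          (solve 5 (λ a b p q m → (a :+ p :* m) :* (b :+ q :* m)
                       := a :* b :+ (a :* q :+ p :* (b :+ q :* m)) :* m)
                 refl (seq x k) (seq y k) p q (pw ℓ k))

  -- ℓ^m divides x in ℤ_ℓ, i.e. m ≤ v_ℓ(x) (with v_ℓ(0) = ∞)
  infix 4 _≤v_
  _≤v_ : ℕ → ℤ[ ℓ ] → Set
  m ≤v x = ∃ λ q → seq x m ≡ q * pw ℓ m

  infix 4 _≈_
  _≈_ : ℤ[ ℓ ] → ℤ[ ℓ ] → Set
  x ≈ y = ∀ k → k ≤v (x ⊖ y)

  0ℓ : ℤ[ ℓ ]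
  0ℓ = fromℤ (+ 0)

  Vec2 : Set
  Vec2 = Fin 2 → ℤ[ ℓ ]

  Mat2 : Set
  Mat2 = Fin 2 → Fin 2 → ℤ[ ℓ ]

  _·_ : Mat2 → Vec2 → Vec2
  (g · w) i = g i zero ⊗ w zero ⊕ g i (suc zero) ⊗ w (suc zero)

  trace : Mat2 → ℤ[ ℓ ]
  trace g = g zero zero ⊕ g (suc zero) (suc zero)

  IsSl2 : Mat2 → Set
  IsSl2 g = trace g ≈ 0ℓ

  IsEigenvalue : Mat2 → ℤ[ ℓ ] → Set
  IsEigenvalue g ν = ∃ λ (v : Vec2) → ¬ (∀ i → v i ≈ 0ℓ) × (∀ i → (g · v) i ≈ ν ⊗ v i)

  CongVec : ℕ → Vec2 → Vec2 → Set
  CongVec n u v = ∀ i → n ≤v (u i ⊖ v i)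

  -- m ≤ β(w) where β(w) = min of the valuations of the coordinates of w
  _≤β_ : ℕ → Vec2 → Set
  m ≤β w = ∀ i → m ≤v w i

  -- v_ℓ(x) = m exactly (x ≠ 0); no such m exists iff x = 0 (v_ℓ(0) = ∞)
  HasVal : ℕ → ℤ[ ℓ ] → Set
  HasVal m x = m ≤v x × ¬ (suc m ≤v x)

module Submission where

-- Since g has trace zero, Cayley–Hamilton gives g² = −det g, so g w ≡ λ w (mod ℓⁿ) implies
-- (λ² + det g) w ≡ 0 (mod ℓⁿ). If some coordinate of w has valuation j < n − 2(2 + v(λ)),
-- cancelling it leaves λ² ≡ −det g modulo ℓ^(2v(λ) + e + 1) with e ≥ 4. Newton's iteration on the
-- unit part of λ then produces a square root ν of −det g with ν ≡ λ (mod ℓ^(v(λ) + e)), and ν is an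
-- eigenvalue of g with eigenvector (g + ν) w: it lies in the ν-eigenspace because (g − ν)(g + ν) =
-- g² − ν² = 0, and it is nonzero because its i-th coordinate is ≡ (λ + ν) wᵢ, of valuation at most
-- v(λ) + 1 + j < n.

open import Defs
open import Data.Fin using (Fin; zero; suc)
open import Data.Product using (Σ; ∃; _,_; _×_; proj₁; proj₂)
open import Data.Sum as Sum using (_⊎_; inj₁; inj₂; [_,_]′)
open import Relation.Nullary using (¬_; Dec; yes; no; contradiction)
import Relation.Nullary.Decidable as Dec
open import Relation.Binary.PropositionalEquality
open import Function using (_∘_)
import Data.Nat as ℕ
open ℕ using (ℕ; zero; suc; _≤_; _<_; z≤n; s≤s; NonZero)
import Data.Nat.Properties as ℕ
import Data.Nat.Tactic.RingSolver as ℕ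
import Data.Nat.Divisibility as ℕ
open import Data.Nat.Coprimality using (Coprime; coprime-Bézout)
open import Data.Nat.GCD using (module Bézout)
open import Data.Nat.Primality
  using (Prime; euclidsLemma; prime⇒nonZero; prime⇒nonTrivial; prime⇒irreducible)

module ℓ-adic {ℓ : ℕ} where

  open import Data.Integer using (ℤ; +_; -[1+_]; _+_; _*_; -_; _-_; ∣_∣)
  import Data.Integer.Properties as ℤ
  open import Data.Integer.Divisibility.Signed
    using (_∣_; divides; _∣?_; ∣-refl; ∣-trans; ∣m∣n⇒∣m+n; ∣m∣n⇒∣m-n; ∣m⇒∣-m;
           ∣n⇒∣m*n; ∣m⇒∣m*n; *-monoʳ-∣; *-monoˡ-∣; *-cancelˡ-∣; ∣ᵤ⇒∣; ∣⇒∣ᵤ)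
  open import Data.Integer.Tactic.RingSolver using (solve-∀)

  infix 4 ℓ^_∣_
  ℓ^_∣_ : ℕ → ℤ → Set
  ℓ^ k ∣ X = pw ℓ k ∣ X

  pw-+ : ∀ a b → pw ℓ (a ℕ.+ b) ≡ pw ℓ a * pw ℓ b
  pw-+ a b = trans (cong +_ (ℕ.^-distribˡ-+-* ℓ a b)) (ℤ.pos-* (ℓ ℕ.^ a) (ℓ ℕ.^ b))

  ℓ^0∣ : ∀ X → ℓ^ 0 ∣ X
  ℓ^0∣ X = divides X (sym (ℤ.*-identityʳ X))

  ∣-pw* : ∀ a b {X} → ℓ^ b ∣ X → ℓ^ (a ℕ.+ b) ∣ pw ℓ a * X
  ∣-pw* a b {X} d = subst (λ P → P ∣ pw ℓ a * X) (sym (pw-+ a b)) (*-monoʳ-∣ (pw ℓ a) d)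

  ∣-*pw : ∀ a b {X} → ℓ^ a ∣ X → ℓ^ (a ℕ.+ b) ∣ X * pw ℓ b
  ∣-*pw a b {X} d = subst (λ P → P ∣ X * pw ℓ b) (sym (pw-+ a b)) (*-monoˡ-∣ (pw ℓ b) d)

  ∣-≤ : ∀ {a b X} → a ≤ b → ℓ^ b ∣ X → ℓ^ a ∣ X
  ∣-≤ {a} a≤b d with ℕ.m≤n⇒∃[o]m+o≡n a≤b
  ... | o , refl = ∣-trans (divides (pw ℓ o) (trans (pw-+ a o) (ℤ.*-comm (pw ℓ a) (pw ℓ o)))) d

  pw-1 : pw ℓ 1 ≡ + ℓ
  pw-1 = cong +_ (ℕ.*-identityʳ ℓ)

  ℓ^_∣0 : ∀ k → ℓ^ k ∣ + 0
  ℓ^ k ∣0 = divides (+ 0) refl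

  ¬ℓ∣-resp-≡ : ∀ {a u v} → 1 ≤ a → ℓ^ a ∣ v - u → ¬ ℓ^ 1 ∣ u → ¬ ℓ^ 1 ∣ v
  ¬ℓ∣-resp-≡ {a} {u} {v} 1≤a v≡u ℓ∤u ℓ∣v =
    ℓ∤u (subst (ℓ^ 1 ∣_) (back v u) (∣m∣n⇒∣m-n ℓ∣v (∣-≤ {b = a} 1≤a v≡u)))
    where
    back : ∀ v u → v - (v - u) ≡ u
    back = solve-∀

  ∣-diff⇒coherent : ∀ {k X Y} → ℓ^ k ∣ X - Y → ∃ λ q → X ≡ Y + q * pw ℓ k
  ∣-diff⇒coherent {X = X} {Y} (divides q eq) = q , trans (split X Y) (cong (_+_ Y) eq)
    where
    split : ∀ X Y → X ≡ Y + (X - Y)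
    split = solve-∀

  m<2m+1 : ∀ m → m < 2 ℕ.* m ℕ.+ 1
  m<2m+1 m = ℕ.≤-trans (ℕ.≤-reflexive (ℕ.+-comm 1 m)) (ℕ.+-monoˡ-≤ 1 (ℕ.m≤m+n m (m ℕ.+ 0)))

  ≤v⇒∣ : ∀ {k} {x : ℤ[ ℓ ]} → k ≤v x → ℓ^ k ∣ seq x k
  ≤v⇒∣ (q , eq) = divides q eq

  ∣⇒≤v : ∀ {k} {x : ℤ[ ℓ ]} → ℓ^ k ∣ seq x k → k ≤v x
  ∣⇒≤v (divides q eq) = q , eq

  seq-coherent : ∀ (x : ℤ[ ℓ ]) {j} k → j ≤ k → ℓ^ j ∣ seq x k - seq x j
  seq-coherent x zero z≤n = ℓ^0∣ _
  seq-coherent x {j} (suc k) j≤1+k with ℕ.m≤n⇒m<n∨m≡n j≤1+k | coh x k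
  ... | inj₂ refl | _ = subst (ℓ^ j ∣_) (sym (ℤ.+-inverseʳ (seq x j))) (ℓ^ j ∣0)
  ... | inj₁ (s≤s j≤k) | q , eq = subst (ℓ^ j ∣_) (sym (trans (cong (_- seq x j) eq) (shift (seq x k) (seq x j) _)))
    (∣m∣n⇒∣m+n (seq-coherent x k j≤k) (∣-≤ {b = k} j≤k (∣n⇒∣m*n q ∣-refl)))
    where
    shift : ∀ a b c → a + c - b ≡ (a - b) + c
    shift = solve-∀

  ∣-seq⇒≤v : ∀ (x : ℤ[ ℓ ]) {j k} → j ≤ k → ℓ^ j ∣ seq x k → j ≤v x
  ∣-seq⇒≤v x {j} {k} j≤k d =
    ∣⇒≤v {j} {x} (subst (ℓ^ j ∣_) (back (seq x k) (seq x j)) (∣m∣n⇒∣m-n d (seq-coherent x k j≤k)))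
    where
    back : ∀ a b → a - (a - b) ≡ b
    back = solve-∀

  ≤v⇒∣-seq : ∀ (x : ℤ[ ℓ ]) {j k} → j ≤ k → j ≤v x → ℓ^ j ∣ seq x k
  ≤v⇒∣-seq x {j} {k} j≤k p =
    subst (ℓ^ j ∣_) (forth (seq x k) (seq x j)) (∣m∣n⇒∣m+n (seq-coherent x k j≤k) (≤v⇒∣ {j} {x} p))
    where
    forth : ∀ a b → (a - b) + b ≡ a
    forth = solve-∀

  ≤v-weaken : ∀ (x : ℤ[ ℓ ]) {i j} → i ≤ j → j ≤v x → i ≤v x
  ≤v-weaken x {i} {j} i≤j p = ∣-seq⇒≤v x i≤j (∣-≤ {b = j} i≤j (≤v⇒∣ {j} {x} p))

  0≤v : ∀ (x : ℤ[ ℓ ]) → 0 ≤v x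
  0≤v x = ∣⇒≤v {0} {x} (ℓ^0∣ (seq x 0))

  _≤v?_ : ∀ k (x : ℤ[ ℓ ]) → Dec (k ≤v x)
  k ≤v? x = Dec.map′ (∣⇒≤v {k} {x}) (≤v⇒∣ {k} {x}) (pw ℓ k ∣? seq x k)

  valuation? : ∀ N (x : ℤ[ ℓ ]) → N ≤v x ⊎ ∃ λ m → m < N × HasVal m x
  valuation? zero x = inj₁ (0≤v x)
  valuation? (suc N) x with valuation? N x
  ... | inj₂ (m , m<N , val) = inj₂ (m , ℕ.m<n⇒m<1+n m<N , val)
  ... | inj₁ N≤v with suc N ≤v? x
  ...   | yes 1+N≤v = inj₁ 1+N≤v
  ...   | no 1+N≰v = inj₂ (N , ℕ.n<1+n N , N≤v , 1+N≰v)

  ≤β-or-witness : ∀ N (w : Vec2 {ℓ}) → N ≤β w ⊎ Σ (Fin 2) λ i → ∃ λ j → j < N × HasVal j (w i)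
  ≤β-or-witness N w with valuation? N (w zero) | valuation? N (w (suc zero))
  ... | inj₂ (j , j<N , val) | _ = inj₂ (zero , j , j<N , val)
  ... | inj₁ _ | inj₂ (j , j<N , val) = inj₂ (suc zero , j , j<N , val)
  ... | inj₁ p | inj₁ q = inj₁ λ { zero → p ; (suc zero) → q }

  ≤v∧HasVal⇒≤ : ∀ (x : ℤ[ ℓ ]) {N m} → N ≤v x → HasVal m x → N ≤ m
  ≤v∧HasVal⇒≤ x {N} {m} N≤v (_ , 1+m≰v) with N ℕ.≤? m
  ... | yes N≤m = N≤m
  ... | no N≰m = contradiction (≤v-weaken x (ℕ.≰⇒> N≰m) N≤v) 1+m≰v

  HasVal-unique : ∀ (x : ℤ[ ℓ ]) {m n} → HasVal m x → HasVal n x → m ≡ n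
  HasVal-unique x valm valn = ℕ.≤-antisym (≤v∧HasVal⇒≤ x (proj₁ valm) valn) (≤v∧HasVal⇒≤ x (proj₁ valn) valm)

  HasVal⇒unit-multiple : ∀ (x : ℤ[ ℓ ]) {j k} → HasVal j x → j < k
    → ∃ λ r → ¬ ℓ^ 1 ∣ r × seq x k ≡ r * pw ℓ j
  HasVal⇒unit-multiple x {j} (j≤v , 1+j≰v) j<k with ≤v⇒∣-seq x (ℕ.<⇒≤ j<k) j≤v
  ... | divides r eq =
    r , (λ ℓ∣r → 1+j≰v (∣-seq⇒≤v x j<k (subst (ℓ^ suc j ∣_) (sym eq) (∣-*pw 1 j ℓ∣r)))) , eq

  -- a² + bc, which is −det g when the trace a + d vanishes.
  negDet : Mat2 {ℓ} → ℤ[ ℓ ]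
  negDet g = g zero zero ⊗ g zero zero ⊕ g zero (suc zero) ⊗ g (suc zero) zero

  _⊞_·_ : Mat2 {ℓ} → ℤ[ ℓ ] → Vec2 {ℓ} → Vec2 {ℓ}
  (g ⊞ ν · w) i = (g · w) i ⊕ ν ⊗ w i

  trace-∣ : ∀ {g : Mat2 {ℓ}} → IsSl2 g → ∀ k → ℓ^ k ∣ seq (g zero zero) k + seq (g (suc zero) (suc zero)) k
  trace-∣ {g} tr k = subst (ℓ^ k ∣_) (ℤ.+-identityʳ _) (≤v⇒∣ {k} {trace g ⊖ 0ℓ} (tr k))

  cayley-hamilton : ∀ {g : Mat2 {ℓ}} → IsSl2 g → ∀ w i → (g · (g · w)) i ≈ negDet g ⊗ w i
  cayley-hamilton {g} tr w i k = ∣⇒≤v {k} {(g · (g · w)) i ⊖ negDet g ⊗ w i} (row i)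
    where
    a = seq (g zero zero) k
    b = seq (g zero (suc zero)) k
    c = seq (g (suc zero) zero) k
    d = seq (g (suc zero) (suc zero)) k
    w₀ = seq (w zero) k
    w₁ = seq (w (suc zero)) k
    row₀ : ∀ a b c d w₀ w₁ →
      a * (a * w₀ + b * w₁) + b * (c * w₀ + d * w₁) - (a * a + b * c) * w₀ ≡ (a + d) * (b * w₁)
    row₀ = solve-∀
    row₁ : ∀ a b c d w₀ w₁ →
      c * (a * w₀ + b * w₁) + d * (c * w₀ + d * w₁) - (a * a + b * c) * w₁ ≡ (a + d) * (c * w₀ + (d - a) * w₁)
    row₁ = solve-∀
    row : ∀ i → ℓ^ k ∣ seq ((g · (g · w)) i ⊖ negDet g ⊗ w i) k
    row zero = subst (ℓ^ k ∣_) (sym (row₀ a b c d w₀ w₁)) (∣m⇒∣m*n _ (trace-∣ {g} tr k))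
    row (suc zero) = subst (ℓ^ k ∣_) (sym (row₁ a b c d w₀ w₁)) (∣m⇒∣m*n _ (trace-∣ {g} tr k))

  ⊞-eigenvector : ∀ {g : Mat2 {ℓ}} {ν} → IsSl2 g → ν ⊗ ν ≈ negDet g
    → ∀ w i → (g · (g ⊞ ν · w)) i ≈ ν ⊗ (g ⊞ ν · w) i
  ⊞-eigenvector {g} {ν} tr ν²≈D w i k = ∣⇒≤v {k} {(g · (g ⊞ ν · w)) i ⊖ ν ⊗ (g ⊞ ν · w) i}
    (subst (ℓ^ k ∣_) (sym (identity (s (g i zero)) (s (g i (suc zero))) (s ((g · w) zero)) (s ((g · w) (suc zero)))
                                    (s (w zero)) (s (w (suc zero))) (s (w i)) (s ν) (s (negDet g))))
      (∣m∣n⇒∣m-n (≤v⇒∣ {k} {(g · (g · w)) i ⊖ negDet g ⊗ w i} (cayley-hamilton {g} tr w i k))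
                 (∣m⇒∣m*n (s (w i)) (≤v⇒∣ {k} {ν ⊗ ν ⊖ negDet g} (ν²≈D k)))))
    where
    s : ℤ[ ℓ ] → ℤ
    s x = seq x k
    identity : ∀ p q G₀ G₁ w₀ w₁ wᵢ x D →
      p * (G₀ + x * w₀) + q * (G₁ + x * w₁) - x * (p * w₀ + q * w₁ + x * wᵢ)
        ≡ (p * G₀ + q * G₁ - D * wᵢ) - (x * x - D) * wᵢ
    identity = solve-∀

  square-congruence : ∀ {g : Mat2 {ℓ}} {w λ' n} → IsSl2 g → CongVec n (g · w) (λ i → λ' ⊗ w i)
    → ∀ i → n ≤v ((λ' ⊗ λ' ⊖ negDet g) ⊗ w i)
  square-congruence {g} {w} {λ'} {n} tr gw≡λw i = ∣⇒≤v {n} {(λ' ⊗ λ' ⊖ negDet g) ⊗ w i}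
    (subst (ℓ^ n ∣_) (sym (identity (s (g i zero)) (s (g i (suc zero))) (s ((g · w) zero)) (s ((g · w) (suc zero)))
                                   (s (w zero)) (s (w (suc zero))) (s (w i)) (s λ') (s (negDet g))))
      (∣m∣n⇒∣m-n (∣m∣n⇒∣m-n (≤v⇒∣ {n} {(g · (g · w)) i ⊖ negDet g ⊗ w i} (cayley-hamilton {g} tr w i n))
                            (∣m∣n⇒∣m+n (∣n⇒∣m*n (s (g i zero)) (congruent zero))
                                       (∣n⇒∣m*n (s (g i (suc zero))) (congruent (suc zero)))))
                 (∣n⇒∣m*n (s λ') (congruent i))))
    where
    s : ℤ[ ℓ ] → ℤ
    s x = seq x n
    congruent : ∀ j → ℓ^ n ∣ seq ((g · w) j ⊖ λ' ⊗ w j) n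
    congruent j = ≤v⇒∣ {n} {(g · w) j ⊖ λ' ⊗ w j} (gw≡λw j)
    identity : ∀ p q G₀ G₁ w₀ w₁ wᵢ x D →
      (x * x - D) * wᵢ
        ≡ (p * G₀ + q * G₁ - D * wᵢ) - (p * (G₀ - x * w₀) + q * (G₁ - x * w₁)) - x * (p * w₀ + q * w₁ - x * wᵢ)
    identity = solve-∀

  module _ (ℓ-prime : Prime ℓ) where

    private instance
      ℓ-nonZero : NonZero ℓ
      ℓ-nonZero = prime⇒nonZero ℓ-prime

    ℓ>1 : 1 < ℓ
    ℓ>1 = ℕ.nonTrivial⇒n>1 ℓ {{prime⇒nonTrivial ℓ-prime}}

    ∣-cancel-pw : ∀ a b {X} → ℓ^ (a ℕ.+ b) ∣ pw ℓ a * X → ℓ^ b ∣ X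
    ∣-cancel-pw a b {X} d = *-cancelˡ-∣ (pw ℓ a) {{ℕ.m^n≢0 ℓ a}} (subst (λ P → P ∣ pw ℓ a * X) (pw-+ a b) d)

    ℓ^1∣⇒ℓ∣abs : ∀ {X} → ℓ^ 1 ∣ X → ℓ ℕ.∣ ∣ X ∣
    ℓ^1∣⇒ℓ∣abs d = subst (ℕ._∣ _) (ℕ.*-identityʳ ℓ) (∣⇒∣ᵤ d)

    ℓ∣abs⇒ℓ^1∣ : ∀ {X} → ℓ ℕ.∣ ∣ X ∣ → ℓ^ 1 ∣ X
    ℓ∣abs⇒ℓ^1∣ d = ∣ᵤ⇒∣ (subst (ℕ._∣ _) (sym (ℕ.*-identityʳ ℓ)) d)

    ℓ∣m*n⇒ℓ∣m⊎ℓ∣n : ∀ X Y → ℓ^ 1 ∣ X * Y → ℓ^ 1 ∣ X ⊎ ℓ^ 1 ∣ Y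
    ℓ∣m*n⇒ℓ∣m⊎ℓ∣n X Y d = Sum.map ℓ∣abs⇒ℓ^1∣ ℓ∣abs⇒ℓ^1∣
      (euclidsLemma ∣ X ∣ ∣ Y ∣ ℓ-prime (subst (ℓ ℕ.∣_) (ℤ.abs-* X Y) (ℓ^1∣⇒ℓ∣abs d)))

    ∣-*unit-cancel : ∀ e {X r} → ¬ ℓ^ 1 ∣ r → ℓ^ e ∣ X * r → ℓ^ e ∣ X
    ∣-*unit-cancel zero {X} _ _ = ℓ^0∣ X
    ∣-*unit-cancel (suc e) {X} {r} ℓ∤r d with ℓ∣m*n⇒ℓ∣m⊎ℓ∣n X r (∣-≤ {b = suc e} (s≤s z≤n) d)
    ... | inj₂ ℓ∣r = contradiction ℓ∣r ℓ∤r
    ... | inj₁ (divides q refl) =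
      subst (ℓ^ suc e ∣_) (ℤ.*-comm (pw ℓ 1) q)
        (∣-pw* 1 e (∣-*unit-cancel e ℓ∤r (∣-cancel-pw 1 e (subst (ℓ^ suc e ∣_) (regroup q (pw ℓ 1) r) d))))
      where
      regroup : ∀ q L r → q * L * r ≡ L * (q * r)
      regroup = solve-∀

    ℓ∤⇒coprime : ∀ {n} → ¬ ℓ ℕ.∣ n → Coprime ℓ n
    ℓ∤⇒coprime ℓ∤n (d∣ℓ , d∣n) with prime⇒irreducible ℓ-prime d∣ℓ
    ... | inj₁ d≡1 = d≡1
    ... | inj₂ refl = contradiction d∣n ℓ∤n

    pos-+*≡* : ∀ a b c d e → a ℕ.+ b ℕ.* c ≡ d ℕ.* e → + a + + b * + c ≡ + d * + e
    pos-+*≡* a b c d e eq = begin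
      + a + + b * + c      ≡⟨ cong (_+_ (+ a)) (ℤ.pos-* b c) ⟨
      + a + + (b ℕ.* c)    ≡⟨ ℤ.pos-+ a (b ℕ.* c) ⟨
      + (a ℕ.+ b ℕ.* c)    ≡⟨ cong +_ eq ⟩
      + (d ℕ.* e)          ≡⟨ ℤ.pos-* d e ⟩
      + d * + e            ∎
      where open ≡-Reasoning

    unit-inverse : ∀ {u} → ¬ ℓ^ 1 ∣ u → ∃ λ s → ℓ^ 1 ∣ u * s - + 1
    unit-inverse {+ n} ℓ∤u with coprime-Bézout (ℓ∤⇒coprime (ℓ∤u ∘ ℓ∣abs⇒ℓ^1∣))
    ... | Bézout.+- x y eq = - + y , divides (- + x) (begin
      + n * - + y - + 1    ≡⟨ negate (+ n) (+ y) ⟩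
      - (+ 1 + + y * + n)  ≡⟨ cong -_ (pos-+*≡* 1 y n x ℓ eq) ⟩
      - (+ x * + ℓ)        ≡⟨ ℤ.neg-distribˡ-* (+ x) (+ ℓ) ⟩
      - + x * + ℓ          ≡⟨ cong (_*_ (- + x)) pw-1 ⟨
      - + x * pw ℓ 1       ∎)
      where
      open ≡-Reasoning
      negate : ∀ n y → n * - y - + 1 ≡ - (+ 1 + y * n)
      negate = solve-∀
    ... | Bézout.-+ x y eq = + y , divides (+ x) (begin
      + n * + y - + 1          ≡⟨ cong (_- + 1) (ℤ.*-comm (+ n) (+ y)) ⟩
      + y * + n - + 1          ≡⟨ cong (_- + 1) (pos-+*≡* 1 x ℓ y n eq) ⟨
      + 1 + + x * + ℓ - + 1    ≡⟨ cancel (+ x * + ℓ) ⟩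
      + x * + ℓ                ≡⟨ cong (_*_ (+ x)) pw-1 ⟨
      + x * pw ℓ 1             ∎)
      where
      open ≡-Reasoning
      cancel : ∀ z → + 1 + z - + 1 ≡ z
      cancel = solve-∀
    unit-inverse { -[1+ n ]} ℓ∤u with unit-inverse {+ suc n} (ℓ∤u ∘ ∣m⇒∣-m)
    ... | s , d = - s , subst (ℓ^ 1 ∣_) (negate (+ suc n) s) d
      where
      negate : ∀ n s → n * s - + 1 ≡ - n * - s - + 1
      negate = solve-∀

    ℓ≢2⇒ℓ∤2 : ℓ ≢ 2 → ¬ ℓ^ 1 ∣ + 2
    ℓ≢2⇒ℓ∤2 ℓ≢2 ℓ∣2 = ℓ≢2 (ℕ.≤-antisym (ℕ.∣⇒≤ (ℓ^1∣⇒ℓ∣abs ℓ∣2)) ℓ>1)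

    ℓ²∤2 : ¬ ℓ^ 2 ∣ + 2
    ℓ²∤2 ℓ²∣2 = ℕ.<⇒≱ {2} {4} (s≤s (s≤s (s≤s z≤n)))
      (ℕ.≤-trans (ℕ.*-mono-≤ ℓ>1 (ℕ.*-mono-≤ ℓ>1 ℕ.≤-refl)) (ℕ.∣⇒≤ (∣⇒∣ᵤ ℓ²∣2)))

    -- The linearised equation of a Newton step for square roots. For odd ℓ the solution t is a multiple
    -- of ℓ; for ℓ = 2 the factor 2 supplies the missing power of ℓ.
    square-correction : ∀ {u} r → ¬ ℓ^ 1 ∣ u → ∃ λ t → ℓ^ 2 ∣ r * pw ℓ 1 + + 2 * u * t
    square-correction {u} r ℓ∤u with ℓ ℕ.≟ 2
    ... | yes ℓ≡2 with unit-inverse ℓ∤u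
    ...   | s , ℓ∣us-1 = - (r * s) , subst (ℓ^ 2 ∣_) (begin
      pw ℓ 1 * (r * - (u * s - + 1))      ≡⟨ expand (pw ℓ 1) r u s ⟩
      r * pw ℓ 1 + pw ℓ 1 * u * - (r * s)  ≡⟨ cong (λ p → r * pw ℓ 1 + pw p 1 * u * - (r * s)) ℓ≡2 ⟩
      r * pw ℓ 1 + + 2 * u * - (r * s)     ∎)
      (∣-pw* 1 1 (∣n⇒∣m*n r (∣m⇒∣-m ℓ∣us-1)))
      where
      open ≡-Reasoning
      expand : ∀ L r u s → L * (r * - (u * s - + 1)) ≡ r * L + L * u * - (r * s)
      expand = solve-∀
    square-correction {u} r ℓ∤u | no ℓ≢2
      with unit-inverse {+ 2 * u} ([ ℓ≢2⇒ℓ∤2 ℓ≢2 , ℓ∤u ]′ ∘ ℓ∣m*n⇒ℓ∣m⊎ℓ∣n (+ 2) u)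
    ...   | s , ℓ∣2us-1 = - (r * pw ℓ 1 * s) , subst (ℓ^ 2 ∣_) (expand (pw ℓ 1) r u s)
      (∣-pw* 1 1 (∣n⇒∣m*n r (∣m⇒∣-m ℓ∣2us-1)))
      where
      expand : ∀ L r u s → L * (r * - (+ 2 * u * s - + 1)) ≡ r * L + + 2 * u * - (r * L * s)
      expand = solve-∀

    square-level : ∀ e m → pw ℓ (e ℕ.+ (2 ℕ.* m ℕ.+ 1)) ≡ pw ℓ e * (pw ℓ m * pw ℓ m) * pw ℓ 1
    square-level e m = begin
      pw ℓ (e ℕ.+ (2 ℕ.* m ℕ.+ 1))        ≡⟨ cong (λ k → pw ℓ (e ℕ.+ k)) (split m) ⟩
      pw ℓ (e ℕ.+ (m ℕ.+ (m ℕ.+ 1)))      ≡⟨ pw-+ e _ ⟩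
      pw ℓ e * pw ℓ (m ℕ.+ (m ℕ.+ 1))     ≡⟨ cong (_*_ (pw ℓ e)) (trans (pw-+ m _) (cong (_*_ (pw ℓ m)) (pw-+ m 1))) ⟩
      pw ℓ e * (pw ℓ m * (pw ℓ m * pw ℓ 1)) ≡⟨ regroup (pw ℓ e) (pw ℓ m) (pw ℓ 1) ⟩
      pw ℓ e * (pw ℓ m * pw ℓ m) * pw ℓ 1 ∎
      where
      open ≡-Reasoning
      split : ∀ m → 2 ℕ.* m ℕ.+ 1 ≡ m ℕ.+ (m ℕ.+ 1)
      split = ℕ.solve-∀
      regroup : ∀ P A L → P * (A * (A * L)) ≡ P * (A * A) * L
      regroup = solve-∀

    square-root-step : ∀ e m {u} D → 2 ≤ e → ¬ ℓ^ 1 ∣ u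
      → ℓ^ (e ℕ.+ (2 ℕ.* m ℕ.+ 1)) ∣ u * pw ℓ m * (u * pw ℓ m) - D
      → ∃ λ v → ℓ^ e ∣ v - u × ℓ^ (suc e ℕ.+ (2 ℕ.* m ℕ.+ 1)) ∣ v * pw ℓ m * (v * pw ℓ m) - D
    square-root-step e m {u} D 2≤e ℓ∤u (divides r eq) with square-correction r ℓ∤u
    ... | t , ℓ²∣c = u + t * P , divides t (shift u t P) , subst₂ _∣_ modulus (sym expansion) ℓ²P·A²∣
      where
      open ≡-Reasoning
      P = pw ℓ e
      A = pw ℓ m
      L = pw ℓ 1
      shift : ∀ u t P → u + t * P - u ≡ t * P
      shift = solve-∀
      newton : ∀ u t P A D → (u + t * P) * A * ((u + t * P) * A) - D
                             ≡ (u * A * (u * A) - D) + (+ 2 * u * t + t * t * P) * (P * (A * A))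
      newton = solve-∀
      collect : ∀ r P A L X → r * (P * (A * A) * L) + X * (P * (A * A)) ≡ (r * L + X) * (P * (A * A))
      collect = solve-∀
      expansion : (u + t * P) * A * ((u + t * P) * A) - D ≡ (r * L + (+ 2 * u * t + t * t * P)) * (P * (A * A))
      expansion = begin
        (u + t * P) * A * ((u + t * P) * A) - D                              ≡⟨ newton u t P A D ⟩
        (u * A * (u * A) - D) + (+ 2 * u * t + t * t * P) * (P * (A * A))
          ≡⟨ cong (λ Z → Z + (+ 2 * u * t + t * t * P) * (P * (A * A))) (trans eq (cong (_*_ r) (square-level e m))) ⟩
        r * (P * (A * A) * L) + (+ 2 * u * t + t * t * P) * (P * (A * A))    ≡⟨ collect r P A L _ ⟩
        (r * L + (+ 2 * u * t + t * t * P)) * (P * (A * A))                  ∎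
      ℓ²∣tail : ℓ^ 2 ∣ r * L + (+ 2 * u * t + t * t * P)
      ℓ²∣tail = subst (ℓ^ 2 ∣_) (ℤ.+-assoc (r * L) _ _)
        (∣m∣n⇒∣m+n ℓ²∣c (∣n⇒∣m*n (t * t) (∣-≤ {b = e} 2≤e ∣-refl)))
      modulus : pw ℓ 2 * (P * (A * A)) ≡ pw ℓ (suc e ℕ.+ (2 ℕ.* m ℕ.+ 1))
      modulus = begin
        pw ℓ 2 * (P * (A * A))          ≡⟨ cong (_* (P * (A * A))) (pw-+ 1 1) ⟩
        L * L * (P * (A * A))           ≡⟨ regroup L (P * (A * A)) ⟩
        L * (P * (A * A) * L)           ≡⟨ cong (_*_ L) (square-level e m) ⟨
        L * pw ℓ (e ℕ.+ (2 ℕ.* m ℕ.+ 1)) ≡⟨ pw-+ 1 (e ℕ.+ (2 ℕ.* m ℕ.+ 1)) ⟨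
        pw ℓ (suc e ℕ.+ (2 ℕ.* m ℕ.+ 1)) ∎
        where
        regroup : ∀ L Q → L * L * Q ≡ L * (Q * L)
        regroup = solve-∀
      ℓ²P·A²∣ : pw ℓ 2 * (P * (A * A)) ∣ (r * L + (+ 2 * u * t + t * t * P)) * (P * (A * A))
      ℓ²P·A²∣ = *-monoˡ-∣ (P * (A * A)) ℓ²∣tail

    ≤v-cancel : ∀ (x y : ℤ[ ℓ ]) {j} k → HasVal j y → (j ℕ.+ k) ≤v (x ⊗ y) → k ≤v x
    ≤v-cancel x y zero _ _ = 0≤v x
    ≤v-cancel x y {j} (suc k) val xy with HasVal⇒unit-multiple y val (ℕ.m<m+n j {suc k} (s≤s z≤n))
    ... | r , ℓ∤r , eq = ∣-seq⇒≤v x (ℕ.m≤n+m (suc k) j)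
      (∣-*unit-cancel (suc k) ℓ∤r (∣-cancel-pw j (suc k)
        (subst (ℓ^ j ℕ.+ suc k ∣_) regroup (≤v⇒∣ {j ℕ.+ suc k} {x ⊗ y} xy))))
      where
      X = seq x (j ℕ.+ suc k)
      rearrange : ∀ X r P → X * (r * P) ≡ P * (X * r)
      rearrange = solve-∀
      regroup : X * seq y (j ℕ.+ suc k) ≡ pw ℓ j * (X * r)
      regroup = trans (cong (_*_ X) eq) (rearrange X r (pw ℓ j))

    square-root : ∀ (x D : ℤ[ ℓ ]) {m} e → 2 ≤ e → HasVal m x
      → (e ℕ.+ (2 ℕ.* m ℕ.+ 1)) ≤v (x ⊗ x ⊖ D)
      → ∃ λ ν → ν ⊗ ν ≈ D × (m ℕ.+ e) ≤v (ν ⊖ x)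
    square-root x D {m} e 2≤e val x²≡D = ν , ν²≈D , ν≡x
      where
      A = pw ℓ m
      N = e ℕ.+ (2 ℕ.* m ℕ.+ 1)

      m<N : m < N
      m<N = ℕ.≤-trans (m<2m+1 m) (ℕ.m≤n+m _ e)

      level : ℕ → ℕ
      level k = (k ℕ.+ e) ℕ.+ (2 ℕ.* m ℕ.+ 1)

      IsApprox : ℕ → ℤ → Set
      IsApprox k u = ¬ ℓ^ 1 ∣ u × ℓ^ level k ∣ u * A * (u * A) - seq D (level k)

      start : ∃ λ u → ¬ ℓ^ 1 ∣ u × seq x N ≡ u * A
      start = HasVal⇒unit-multiple x val m<N
      u₀ = proj₁ start

      improve : ∀ k {u} → IsApprox k u → ∃ λ v → IsApprox (suc k) v × ℓ^ (k ℕ.+ e) ∣ v - u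
      improve k {u} (ℓ∤u , approx) =
        let v , v≡u , approx′ = stepped
        in  v , (¬ℓ∣-resp-≡ {a = k ℕ.+ e} (ℕ.<⇒≤ 2≤k+e) v≡u ℓ∤u , approx′) , v≡u
        where
        2≤k+e : 2 ≤ k ℕ.+ e
        2≤k+e = ℕ.≤-trans 2≤e (ℕ.m≤n+m e k)
        X = u * A * (u * A)
        telescope : ∀ X D D′ → (X - D) - (D′ - D) ≡ X - D′
        telescope = solve-∀
        -- D is only coherent modulo ℓ^(level k), so the step aims at D's next approximation directly.
        approx-next-level : ℓ^ level k ∣ X - seq D (level (suc k))
        approx-next-level = subst (ℓ^ level k ∣_) (telescope X (seq D (level k)) (seq D (level (suc k))))
          (∣m∣n⇒∣m-n approx (seq-coherent D (level (suc k)) (ℕ.n≤1+n (level k))))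
        stepped = square-root-step (k ℕ.+ e) m (seq D (level (suc k))) 2≤k+e ℓ∤u approx-next-level

      approx : ∀ k → Σ ℤ (IsApprox k)
      approx zero = u₀ , proj₁ (proj₂ start) ,
        subst (λ z → ℓ^ N ∣ z * z - seq D N) (proj₂ (proj₂ start)) (≤v⇒∣ {N} {x ⊗ x ⊖ D} x²≡D)
      approx (suc k) = proj₁ next , proj₁ (proj₂ next)
        where next = improve k (proj₂ (approx k))

      root : ℕ → ℤ
      root k = proj₁ (approx k)

      root-step : ∀ k → ℓ^ (k ℕ.+ e) ∣ root (suc k) - root k
      root-step k = proj₂ (proj₂ (improve k (proj₂ (approx k))))

      root-near : ∀ k → ℓ^ e ∣ root k - u₀
      root-near zero = subst (ℓ^ e ∣_) (sym (ℤ.+-inverseʳ u₀)) (ℓ^ e ∣0)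
      root-near (suc k) = subst (ℓ^ e ∣_) (telescope (root (suc k)) (root k) u₀)
        (∣m∣n⇒∣m+n (∣-≤ {b = k ℕ.+ e} (ℕ.m≤n+m e k) (root-step k)) (root-near k))
        where
        telescope : ∀ a b c → (a - b) + (b - c) ≡ a - c
        telescope = solve-∀

      ν : ℤ[ ℓ ]
      ν = mk (λ k → root k * A) λ k → ∣-diff⇒coherent {k} (subst (ℓ^ k ∣_) (distrib (root (suc k)) (root k) A)
            (∣m⇒∣m*n A (∣-≤ {b = k ℕ.+ e} (ℕ.m≤m+n k e) (root-step k))))
        where
        distrib : ∀ a b A → (a - b) * A ≡ a * A - b * A
        distrib = solve-∀

      ν²≈D : ν ⊗ ν ≈ D
      ν²≈D k = ∣⇒≤v {k} {ν ⊗ ν ⊖ D}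
        (subst (ℓ^ k ∣_) (telescope (root k * A * (root k * A)) (seq D (level k)) (seq D k))
        (∣m∣n⇒∣m+n (∣-≤ {b = level k} k≤level (proj₂ (proj₂ (approx k)))) (seq-coherent D (level k) k≤level)))
        where
        k≤level : k ≤ level k
        k≤level = ℕ.≤-trans (ℕ.m≤m+n k e) (ℕ.m≤m+n _ _)
        telescope : ∀ X D D′ → (X - D) + (D - D′) ≡ X - D′
        telescope = solve-∀

      ν≡x : (m ℕ.+ e) ≤v (ν ⊖ x)
      ν≡x = ∣⇒≤v {m ℕ.+ e} {ν ⊖ x}
        (subst (ℓ^ m ℕ.+ e ∣_) (sym (split (root (m ℕ.+ e)) A u₀ (seq x (m ℕ.+ e)) (proj₂ (proj₂ start))))
        (∣m∣n⇒∣m+n (∣-pw* m e (root-near (m ℕ.+ e))) (seq-coherent x N m+e≤N)))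
        where
        m+e≤N : m ℕ.+ e ≤ N
        m+e≤N = ℕ.≤-trans (ℕ.≤-reflexive (ℕ.+-comm m e)) (ℕ.+-monoʳ-≤ e (ℕ.<⇒≤ (m<2m+1 m)))
        regroup : ∀ r A u X → r * A - X ≡ A * (r - u) + (u * A - X)
        regroup = solve-∀
        split : ∀ r A u X {Y} → Y ≡ u * A → r * A - X ≡ A * (r - u) + (Y - X)
        split r A u X refl = regroup r A u X

    eigenvalue-near : ∀ {g : Mat2 {ℓ}} {w : Vec2 {ℓ}} {λ' : ℤ[ ℓ ]} {m j} i e → 2 ≤ e → IsSl2 g
      → CongVec (j ℕ.+ (e ℕ.+ (2 ℕ.* m ℕ.+ 1))) (g · w) (λ i → λ' ⊗ w i)
      → HasVal m λ' → HasVal j (w i)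
      → ∃ λ ν → IsEigenvalue g ν × (m ℕ.+ e) ≤v (ν ⊖ λ')
    eigenvalue-near {g} {w} {λ'} {m} {j} i e 2≤e tr gw≡λw valλ valw =
      ν , (g ⊞ ν · w , nonzero , ⊞-eigenvector {g} {ν} tr ν²≈D w) , ν≡λ
      where
      k = e ℕ.+ (2 ℕ.* m ℕ.+ 1)
      n = j ℕ.+ k

      λ²≡D : k ≤v (λ' ⊗ λ' ⊖ negDet g)
      λ²≡D = ≤v-cancel (λ' ⊗ λ' ⊖ negDet g) (w i) k valw (square-congruence {g} {w} {λ'} {n} tr gw≡λw i)

      root = square-root λ' (negDet g) e 2≤e valλ λ²≡D
      ν = proj₁ root
      ν²≈D = proj₁ (proj₂ root)
      ν≡λ = proj₂ (proj₂ root)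

      -- If (g + ν) w vanished, (λ + ν) wᵢ ≡ 0 would force ℓ^(m+2) ∣ 2λ, i.e. ℓ² ∣ 2.
      nonzero : ¬ (∀ i → (g ⊞ ν · w) i ≈ 0ℓ)
      nonzero v≈0 = ℓ²∤2 (≤v⇒∣ {2} {fromℤ (+ 2)} (≤v-cancel (fromℤ (+ 2)) λ' 2 valλ 2λ≡0))
        where
        sum-identity : ∀ G y x w → (y + x) * w ≡ ((G + x * w) - + 0) - (G - y * w)
        sum-identity = solve-∀
        λ+ν≡0 : k ≤v (λ' ⊕ ν)
        λ+ν≡0 = ≤v-cancel (λ' ⊕ ν) (w i) k valw (∣⇒≤v {n} {(λ' ⊕ ν) ⊗ w i}
          (subst (ℓ^ n ∣_) (sym (sum-identity (seq ((g · w) i) n) (seq λ' n) (seq ν n) (seq (w i) n)))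
            (∣m∣n⇒∣m-n (≤v⇒∣ {n} {(g ⊞ ν · w) i ⊖ 0ℓ} (v≈0 i n))
                       (≤v⇒∣ {n} {(g · w) i ⊖ λ' ⊗ w i} (gw≡λw i)))))
        double : ∀ y x → + 2 * y ≡ (y + x) - (x - y)
        double = solve-∀
        m+2≤k : m ℕ.+ 2 ≤ k
        m+2≤k = ℕ.≤-trans (ℕ.≤-reflexive (ℕ.+-comm m 2)) (ℕ.+-mono-≤ 2≤e (ℕ.<⇒≤ (m<2m+1 m)))
        2λ≡0 : (m ℕ.+ 2) ≤v (fromℤ (+ 2) ⊗ λ')
        2λ≡0 = ∣⇒≤v {m ℕ.+ 2} {fromℤ (+ 2) ⊗ λ'}
          (subst (ℓ^ m ℕ.+ 2 ∣_) (sym (double (seq λ' (m ℕ.+ 2)) (seq ν (m ℕ.+ 2))))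
          (∣m∣n⇒∣m-n (≤v⇒∣ {m ℕ.+ 2} {λ' ⊕ ν} (≤v-weaken (λ' ⊕ ν) m+2≤k λ+ν≡0))
                     (≤v⇒∣ {m ℕ.+ 2} {ν ⊖ λ'} (≤v-weaken (ν ⊖ λ') (ℕ.+-monoʳ-≤ m 2≤e) ν≡λ))))

open ℓ-adic using (valuation?; ≤β-or-witness; ≤v∧HasVal⇒≤; HasVal-unique; ≤v-weaken; 0≤v; eigenvalue-near)
open import Data.Nat using (_+_; _*_; _∸_)

exponent-split : ∀ {n} j m → j < n ∸ 2 * (2 + m) → ∃ λ e → 3 ≤ e × n ≡ j + (e + (2 * m + 1))
exponent-split {n} j m j<n∸K with ℕ.m≤n⇒∃[o]m+o≡n j<n∸K
... | o , eq = 4 + o , s≤s (s≤s (s≤s z≤n)) , (begin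
    n                          ≡⟨ ℕ.m∸n+n≡m K≤n ⟨
    n ∸ K + K                  ≡⟨ cong (_+ K) eq ⟨
    suc j + o + K              ≡⟨ regroup j o m ⟩
    j + (4 + o + (2 * m + 1))  ∎)
  where
  open ≡-Reasoning
  K = 2 * (2 + m)
  K≤n : K ≤ n
  K≤n = ℕ.<⇒≤ (ℕ.m∸n≢0⇒n<m (λ n∸K≡0 → ℕ.n≮0 (subst (j <_) n∸K≡0 j<n∸K)))
  regroup : ∀ j o m → suc j + o + 2 * (2 + m) ≡ j + (4 + o + (2 * m + 1))
  regroup = ℕ.solve-∀

eigenvalue-of-small-β : ∀ {ℓ} → Prime ℓ → {g : Mat2 {ℓ}} → IsSl2 g → {w : Vec2 {ℓ}} {λ' : ℤ[ ℓ ]} {n m : ℕ}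
  → CongVec n (g · w) (λ i → λ' ⊗ w i) → HasVal m λ'
  → (i : Fin 2) → ∀ j → j < n ∸ 2 * (2 + m) → HasVal j (w i)
  → ∃ λ ν → IsEigenvalue g ν × (∀ m′ → m′ ≤v λ' → (m′ + 3) ≤v (ν ⊖ λ'))
eigenvalue-of-small-β ℓ-prime {g} tr {w} {λ'} {n} {m} gw≡λw valλ i j j<N valw =
  let e , 3≤e , n≡ = exponent-split {n} j m j<N
      gw≡λw′ = subst (λ n → CongVec n (g · w) (λ i → λ' ⊗ w i)) n≡ gw≡λw
      ν , eigen , ν≡λ = eigenvalue-near ℓ-prime {g} {w} {λ'} {m} {j} i e (ℕ.<⇒≤ 3≤e) tr gw≡λw′ valλ valw
  in  ν , eigen , λ m′ m′≤vλ → ≤v-weaken (ν ⊖ λ') (ℕ.+-mono-≤ (≤v∧HasVal⇒≤ λ' m′≤vλ valλ) 3≤e) ν≡λ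

lemma5p4 : (ℓ : ℕ) → Prime ℓ → (g : Mat2 {ℓ}) → IsSl2 g → (w : Vec2 {ℓ})
    → (λ' : ℤ[ ℓ ]) → (n : ℕ) → .{{_ : NonZero n}}
    → CongVec n (g · w) (λ i → λ' ⊗ w i)
    → (∃ λ ν → IsEigenvalue g ν × (∀ m → m ≤v λ' → (m + 3) ≤v (ν ⊖ λ')))
    ⊎ (∀ m → HasVal m λ' → (n ∸ 2 * (2 + m)) ≤β w)
lemma5p4 ℓ ℓ-prime g tr w λ' n gw≡λw with valuation? n λ'
... | inj₁ n≤vλ = inj₂ λ m valλ →
  let n≤2[2+m] = ℕ.≤-trans (≤v∧HasVal⇒≤ λ' n≤vλ valλ) (ℕ.≤-trans (ℕ.m≤n+m m 2) (ℕ.m≤m+n (2 + m) _))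
  in  subst (_≤β w) (sym (ℕ.m≤n⇒m∸n≡0 n≤2[2+m])) (λ i → 0≤v (w i))
... | inj₂ (m , _ , valλ) with ≤β-or-witness (n ∸ 2 * (2 + m)) w
...   | inj₁ β≥ = inj₂ λ m′ valλ′ →
  subst (λ k → (n ∸ 2 * (2 + k)) ≤β w) (HasVal-unique λ' valλ valλ′) β≥
...   | inj₂ (i , j , j<N , valw) = inj₁ (eigenvalue-of-small-β ℓ-prime {g} tr {w} {λ'} {n} {m} gw≡λw valλ i j j<N valw)
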